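{- Let $G$ be a connected graph of order $n\ge 3$ and let $W\subsetneq V(G)$ be a twin set of cardinality $k\ge 2$. (1) If $W$ induces an edgeless graph, then $\eta_p(G)\ge\beta_p(G)\ge k$. (2) If $W$ induces a complete graph, then $\eta_p(G)\ge\beta_p(G)\ge k+1$. (3) If $W$ consists of leaves, then $\eta_p(G)\ge k+1$.
   Context: Graphs are finite, simple, undirected and connected. Two vertices $u,v$ are twins if $N(u)=N(v)$ or $N[u]=N[v]$; a twin set is a set of pairwise twin vertices. A leaf is a vertex of degree 1. For $v\in V(G)$, $S\subseteq V(G)$: $d(v,S)=\min\{d(v,w):w\in S\}$. For a partition $\Pi=\{S_1,\dots,S_k\}$ of $V(G)$, $r(u|\Pi)=(d(u,S_1),\dots,d(u,S_k))$; $\Pi$ is resolving if $r(u|\Pi)\ne r(v|\Pi)$ for all distinct $u,v$, and dominating if each vertex $v$ has $d(v,S_j)=1$ for some $j$. $\beta_p(G)$ (resp. $\eta_p(G)$) is the minimum cardinality of a resolving partition (resp. a partition both resolving and dominating). -}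

module Defs where

open import Data.Nat using (ℕ; zero; suc; _≤_; _<_)
open import Data.Fin using (Fin)
open import Data.Fin.Subset using (Subset; _∈_; _∉_; ∣_∣)
open import Data.Bool using (Bool; true; false)
open import Data.Product using (Σ; ∃; ∃-syntax; _×_; _,_)
open import Data.Sum using (_⊎_)
open import Relation.Nullary using (¬_)
open import Relation.Binary.PropositionalEquality using (_≡_; _≢_)
open import Function.Bundles using (_⇔_)

record Graph (n : ℕ) : Set where
  field
    adj     : Fin n → Fin n → Bool
    adj-sym : ∀ u v → adj u v ≡ adj v u
    adj-irr : ∀ v → adj v v ≡ false
open Graph public

module _ {n : ℕ} (G : Graph n) where

  Adj : Fin n → Fin n → Set
  Adj u v = adj G u v ≡ true

  data Walk : Fin n → Fin n → ℕ → Set where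
    nil  : ∀ {u} → Walk u u 0
    cons : ∀ {u v w l} → Adj u v → Walk v w l → Walk u w (suc l)

  Connected : Set
  Connected = ∀ u v → ∃[ l ] Walk u v l

  Dist : Fin n → Fin n → ℕ → Set
  Dist u v d = Walk u v d × (∀ l → l < d → ¬ Walk u v l)

  Twins : Fin n → Fin n → Set
  Twins u v = (∀ w → Adj u w ⇔ Adj v w)
            ⊎ (∀ w → (w ≡ u ⊎ Adj u w) ⇔ (w ≡ v ⊎ Adj v w))

  TwinSet : Subset n → Set
  TwinSet W = ∀ u v → u ∈ W → v ∈ W → u ≢ v → Twins u v

  IsLeaf : Fin n → Set
  IsLeaf v = ∃[ x ] (Adj v x × (∀ y → Adj v y → y ≡ x))

  InducesEdgeless : Subset n → Set
  InducesEdgeless W = ∀ u v → u ∈ W → v ∈ W → ¬ Adj u v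

  InducesComplete : Subset n → Set
  InducesComplete W = ∀ u v → u ∈ W → v ∈ W → u ≢ v → Adj u v

-- A partition of Fin n into p (nonempty) classes S_0..S_{p-1}: S_j = cls ⁻¹ j
record Partition (n p : ℕ) : Set where
  field
    cls  : Fin n → Fin p
    surj : ∀ j → ∃[ v ] cls v ≡ j
open Partition public

module _ {n : ℕ} (G : Graph n) where

  DistToClass : ∀ {p} → Partition n p → Fin n → Fin p → ℕ → Set
  DistToClass Π u j d =
    (∃[ w ] (cls Π w ≡ j × Walk G u w d))
    × (∀ w l → cls Π w ≡ j → l < d → ¬ Walk G u w l)

  Resolving : ∀ {p} → Partition n p → Set
  Resolving Π = ∀ u v → u ≢ v →
    ∃[ j ] ∃[ d₁ ] ∃[ d₂ ] (DistToClass Π u j d₁ × DistToClass Π v j d₂ × d₁ ≢ d₂)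

  Dominating : ∀ {p} → Partition n p → Set
  Dominating Π = ∀ v → ∃[ j ] DistToClass Π v j 1

  IsPartitionDimension : ℕ → Set
  IsPartitionDimension b =
    (Σ (Partition n b) Resolving)
    × (∀ p (Π : Partition n p) → Resolving Π → b ≤ p)

  IsDomPartitionDimension : ℕ → Set
  IsDomPartitionDimension e =
    (Σ (Partition n e) (λ Π → Resolving Π × Dominating Π))
    × (∀ p (Π : Partition n p) → Resolving Π → Dominating Π → e ≤ p)

-- The whole argument rests on one observation: two twin vertices have the same
-- distance to every set not separating them, so a resolving partition puts the
-- vertices of a twin set W into pairwise distinct classes.  Hence ∣ W ∣ ≤ p for
-- every resolving partition into p classes (part 1), and ∣ W ∣ < p as soon as
-- some class contains no vertex of W.  Parts 2 and 3 therefore reduce to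
-- showing that W cannot meet every class of a resolving (and, for leaves,
-- dominating) partition:
--   * W complete: a vertex x ∉ W adjacent to W is adjacent to all of W, so x
--     and the vertex of W in the class of x are at distance 0 from their own
--     class and at distance 1 from every other class, contradicting resolution;
--   * W made of leaves: all these leaves hang from one common vertex x, and the
--     leaf of W lying in the class of x has no neighbour outside its own class,
--     contradicting domination.
module Submission where

open import Defs
open import Data.Nat using (ℕ; suc; zero; _≤_; _<_; z≤n; s≤s)
open import Data.Nat.Properties using (<-cmp; ≤-antisym; ≤-trans; ≤-refl; n≤1+n; ≮⇒≥; <-irrefl)
open import Data.Fin using (Fin; punchOut) renaming (zero to fzero; suc to fsuc)
open import Data.Fin.Properties using (injective⇒≤; punchOut-injective; suc-injective; any?; ¬∀⟶∃¬)
  renaming (_≟_ to _≟ᶠ_)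
open import Data.Fin.Subset using (Subset; _∈_; _∉_; ∣_∣; inside; outside; Nonempty)
open import Data.Fin.Subset.Properties using (_∈?_)
open import Data.Vec using (_∷_; here; there)
open import Data.Product using (∃-syntax; _×_; _,_; proj₂)
open import Data.Sum using (_⊎_; inj₁; inj₂)
open import Data.Empty using (⊥; ⊥-elim)
open import Relation.Nullary using (¬_; yes; no)
open import Relation.Nullary.Decidable using (_×-dec_)
open import Relation.Binary.PropositionalEquality using (_≡_; _≢_; refl; sym; trans; cong; subst)
open import Relation.Binary.Definitions using (tri<; tri≈; tri>)
open import Function.Bundles using (Equivalence)
import Function.Properties.Equivalence as ⇔

InjectiveOn : ∀ {n p} → Subset n → (Fin n → Fin p) → Set
InjectiveOn W f = ∀ {u v} → u ∈ W → v ∈ W → f u ≡ f v → u ≡ v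

OntoFrom : ∀ {n p} → Subset n → (Fin n → Fin p) → Set
OntoFrom W f = ∀ j → ∃[ w ] (w ∈ W × f w ≡ j)

enumerate : ∀ {n} (W : Subset n) → Fin ∣ W ∣ → Fin n
enumerate (inside  ∷ W) fzero    = fzero
enumerate (inside  ∷ W) (fsuc i) = fsuc (enumerate W i)
enumerate (outside ∷ W) i        = fsuc (enumerate W i)

enumerate-∈ : ∀ {n} (W : Subset n) (i : Fin ∣ W ∣) → enumerate W i ∈ W
enumerate-∈ (inside  ∷ W) fzero    = here
enumerate-∈ (inside  ∷ W) (fsuc i) = there (enumerate-∈ W i)
enumerate-∈ (outside ∷ W) i        = there (enumerate-∈ W i)

enumerate-injective : ∀ {n} (W : Subset n) {i j : Fin ∣ W ∣} →
  enumerate W i ≡ enumerate W j → i ≡ j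
enumerate-injective (inside  ∷ W) {fzero}  {fzero}  eq = refl
enumerate-injective (inside  ∷ W) {fsuc i} {fsuc j} eq =
  cong fsuc (enumerate-injective W (suc-injective eq))
enumerate-injective (outside ∷ W) eq = enumerate-injective W (suc-injective eq)

positive⇒nonempty : ∀ {n} (W : Subset n) → 0 < ∣ W ∣ → Nonempty W
positive⇒nonempty W pos with ∣ W ∣ | enumerate W | enumerate-∈ W
... | suc _ | e | e-∈ = e fzero , e-∈ fzero

module _ {n : ℕ} (W : Subset n) where

  injectiveOn⇒∣W∣≤ : ∀ {p} (f : Fin n → Fin p) → InjectiveOn W f → ∣ W ∣ ≤ p
  injectiveOn⇒∣W∣≤ f inj =
    injective⇒≤ (λ eq → enumerate-injective W (inj (enumerate-∈ W _) (enumerate-∈ W _) eq))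

  injectiveOn⇒∣W∣< : ∀ {p} (f : Fin n → Fin p) → InjectiveOn W f → ¬ OntoFrom W f → suc ∣ W ∣ ≤ p
  injectiveOn⇒∣W∣< {zero}   f inj notOnto = ⊥-elim (notOnto (λ ()))
  injectiveOn⇒∣W∣< {suc p′} f inj notOnto
    with ¬∀⟶∃¬ (suc p′) _ (λ j → any? (λ w → (w ∈? W) ×-dec (f w ≟ᶠ j))) notOnto
  ... | j , missed = s≤s (injective⇒≤ {f = g} g-injective)
    where
    -- f takes its values on W in Fin (1 + p′) minus {j}, identified with Fin p′
    e = enumerate W
    avoids : ∀ i → j ≢ f (e i)
    avoids i eq = missed (e i , enumerate-∈ W i , sym eq)
    g : Fin ∣ W ∣ → Fin p′
    g i = punchOut (avoids i)
    g-injective : ∀ {i i′} → g i ≡ g i′ → i ≡ i′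
    g-injective eq = enumerate-injective W
      (inj (enumerate-∈ W _) (enumerate-∈ W _) (punchOut-injective (avoids _) (avoids _) eq))

module _ {n : ℕ} (G : Graph n) where

  Adj-sym : ∀ {u v} → Adj G u v → Adj G v u
  Adj-sym {u} {v} uv = trans (adj-sym G v u) uv

  Adj-irrefl : ∀ {u} → ¬ Adj G u u
  Adj-irrefl {u} uu with trans (sym (adj-irr G u)) uu
  ... | ()

  Twins-sym : ∀ {u v} → Twins G u v → Twins G v u
  Twins-sym (inj₁ open-twins)   = inj₁ (λ w → ⇔.sym (open-twins w))
  Twins-sym (inj₂ closed-twins) = inj₂ (λ w → ⇔.sym (closed-twins w))

  leavingEdge : ∀ {W : Subset n} {a y l} → a ∈ W → y ∉ W → Walk G a y l →
    ∃[ a′ ] ∃[ x ] (a′ ∈ W × x ∉ W × Adj G a′ x)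
  leavingEdge a∈W y∉W nil = ⊥-elim (y∉W a∈W)
  leavingEdge {W} {a} a∈W y∉W (cons {v = b} ab rest) with b ∈? W
  ... | yes b∈W = leavingEdge b∈W y∉W rest
  ... | no  b∉W = a , b , a∈W , b∉W , ab

  -- two adjacent vertices whose only neighbours are each other form a
  -- component, so a connected graph on at least 3 vertices has no such edge
  noIsolatedEdge : Connected G → 3 ≤ n → ∀ {a b} →
    (∀ y → Adj G a y → y ≡ b) → (∀ y → Adj G b y → y ≡ a) → ⊥
  noIsolatedEdge connected 3≤n {a} {b} onlyB onlyA =
    <-irrefl refl (≤-trans 3≤n (injective⇒≤ code-injective))
    where
    stays : ∀ {c z l} → c ≡ a ⊎ c ≡ b → Walk G c z l → z ≡ a ⊎ z ≡ b
    stays c∈ab nil = c∈ab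
    stays (inj₁ refl) (cons {v = v} av rest) = stays (inj₂ (onlyB v av)) rest
    stays (inj₂ refl) (cons {v = v} bv rest) = stays (inj₁ (onlyA v bv)) rest

    a-or-b : ∀ z → z ≡ a ⊎ z ≡ b
    a-or-b z = stays (inj₁ refl) (proj₂ (connected a z))

    -- every vertex is a or b, so telling them apart injects V(G) into Fin 2
    code : Fin n → Fin 2
    code z with z ≟ᶠ a
    ... | yes _ = fzero
    ... | no  _ = fsuc fzero

    code-injective : ∀ {z z′} → code z ≡ code z′ → z ≡ z′
    code-injective {z} {z′} eq with z ≟ᶠ a | z′ ≟ᶠ a | a-or-b z | a-or-b z′
    ... | yes z≡a | yes z′≡a | _ | _ = trans z≡a (sym z′≡a)
    ... | no z≢a | _ | inj₁ z≡a | _ = ⊥-elim (z≢a z≡a)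
    ... | _ | no z′≢a | _ | inj₁ z′≡a = ⊥-elim (z′≢a z′≡a)
    ... | no _ | no _ | inj₂ z≡b | inj₂ z′≡b = trans z≡b (sym z′≡b)
    code-injective {z} {z′} () | yes _ | no _ | _ | _
    code-injective {z} {z′} () | no _ | yes _ | _ | _

  twinShortcut : ∀ {u v w l} → Twins G u v → Walk G u w (suc l) →
    ∃[ l′ ] (l′ ≤ suc l × Walk G v w l′)
  twinShortcut {l = l} (inj₁ open-twins) (cons {v = a} ua rest) =
    suc l , ≤-refl , cons (Equivalence.to (open-twins a) ua) rest
  twinShortcut {l = l} (inj₂ closed-twins) (cons {v = a} ua rest)
    with Equivalence.to (closed-twins a) (inj₂ ua)
  ... | inj₁ refl = l , n≤1+n l , rest
  ... | inj₂ va   = suc l , ≤-refl , cons va rest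

  module _ {p : ℕ} (Π : Partition n p) where

    distToClass-unique : ∀ {u j d₁ d₂} →
      DistToClass G Π u j d₁ → DistToClass G Π u j d₂ → d₁ ≡ d₂
    distToClass-unique {d₁ = d₁} {d₂} ((w₁ , w₁∈j , walk₁) , min₁) ((w₂ , w₂∈j , walk₂) , min₂)
      with <-cmp d₁ d₂
    ... | tri< d₁<d₂ _ _ = ⊥-elim (min₂ w₁ d₁ w₁∈j d₁<d₂ walk₁)
    ... | tri≈ _ d₁≡d₂ _ = d₁≡d₂
    ... | tri> _ _ d₂<d₁ = ⊥-elim (min₁ w₂ d₂ w₂∈j d₂<d₁ walk₂)

    distToOwnClass : ∀ z → DistToClass G Π z (cls Π z) 0
    distToOwnClass z = (z , refl , nil) , (λ _ _ _ ())

    distToNeighbourClass : ∀ {z y j} → cls Π z ≢ j → Adj G z y → cls Π y ≡ j →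
      DistToClass G Π z j 1
    distToNeighbourClass {z} {y} z∉j zy y∈j = (y , y∈j , cons zy nil) , at-least-1
      where
      at-least-1 : ∀ w l → cls Π w ≡ _ → l < 1 → ¬ Walk G z w l
      at-least-1 w .0 w∈j (s≤s z≤n) nil = z∉j w∈j

    equalDistances⇒unresolved : ∀ {u v} →
      (∀ j → ∃[ d ] (DistToClass G Π u j d × DistToClass G Π v j d)) →
      ¬ (∃[ j ] ∃[ d₁ ] ∃[ d₂ ] (DistToClass G Π u j d₁ × DistToClass G Π v j d₂ × d₁ ≢ d₂))
    equalDistances⇒unresolved same (j , d₁ , d₂ , u-d₁ , v-d₂ , d₁≢d₂) with same j
    ... | d , u-d , v-d =
      d₁≢d₂ (trans (distToClass-unique u-d₁ u-d) (distToClass-unique v-d v-d₂))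

    twinDist-≤ : ∀ {u v j d₁ d₂} → Twins G u v → cls Π u ≡ cls Π v →
      DistToClass G Π u j d₁ → DistToClass G Π v j d₂ → d₂ ≤ d₁
    twinDist-≤ {u} {v} twins same ((w , w∈j , nil) , _) (_ , min₂) =
      ≮⇒≥ (λ pos → min₂ v 0 (trans (sym same) w∈j) pos nil)
    twinDist-≤ twins same ((w , w∈j , walk@(cons _ _)) , _) (_ , min₂)
      with twinShortcut twins walk
    ... | l′ , l′≤ , walk′ = ≮⇒≥ (λ shorter → min₂ w l′ w∈j (≤-trans (s≤s l′≤) shorter) walk′)

    twinsInDistinctClasses : Resolving G Π → ∀ {u v} → Twins G u v → u ≢ v →
      cls Π u ≢ cls Π v
    twinsInDistinctClasses resolving twins u≢v same with resolving _ _ u≢v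
    ... | j , d₁ , d₂ , u-d₁ , v-d₂ , d₁≢d₂ =
      d₁≢d₂ (≤-antisym (twinDist-≤ (Twins-sym twins) (sym same) v-d₂ u-d₁)
                       (twinDist-≤ twins same u-d₁ v-d₂))

    leafUndominated : ∀ {w x} → (∀ y → Adj G w y → y ≡ x) → cls Π x ≡ cls Π w →
      ¬ (∃[ j ] DistToClass G Π w j 1)
    leafUndominated {w} onlyX x∼w (j , (z , z∈j , cons wz nil) , min) =
      min w 0 (trans (sym x∼w) (trans (cong (cls Π) (sym (onlyX z wz))) z∈j)) (s≤s z≤n) nil

  module _ (W : Subset n) (twinSet : TwinSet G W) where

    classInjectiveOn : ∀ {p} (Π : Partition n p) → Resolving G Π →
      InjectiveOn W (cls Π)
    classInjectiveOn Π resolving {u} {v} u∈W v∈W same with u ≟ᶠ v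
    ... | yes u≡v = u≡v
    ... | no  u≢v =
      ⊥-elim (twinsInDistinctClasses Π resolving (twinSet u v u∈W v∈W u≢v) u≢v same)

    twinSet-bound : ∀ {p} (Π : Partition n p) → Resolving G Π → ∣ W ∣ ≤ p
    twinSet-bound Π resolving = injectiveOn⇒∣W∣≤ W (cls Π) (classInjectiveOn Π resolving)

    twinSet-strictBound : ∀ {p} (Π : Partition n p) → Resolving G Π →
      ¬ OntoFrom W (cls Π) → suc ∣ W ∣ ≤ p
    twinSet-strictBound Π resolving =
      injectiveOn⇒∣W∣< W (cls Π) (classInjectiveOn Π resolving)

    -- every vertex outside a complete twin set W adjacent to W is adjacent to all of W
    -- (W consists of closed twins: open twins in W would be adjacent to themselves)
    completeTwinSet-neighbour : InducesComplete G W → ∀ {a x} → a ∈ W → x ∉ W →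
      Adj G a x → ∀ w → w ∈ W → Adj G x w
    completeTwinSet-neighbour complete {a} {x} a∈W x∉W ax w w∈W with w ≟ᶠ a
    ... | yes refl = Adj-sym ax
    ... | no w≢a with twinSet a w a∈W w∈W (λ a≡w → w≢a (sym a≡w))
    ... | inj₁ open-twins =
      ⊥-elim (Adj-irrefl (Equivalence.to (open-twins w) (complete a w a∈W w∈W (λ a≡w → w≢a (sym a≡w)))))
    ... | inj₂ closed-twins with Equivalence.to (closed-twins x) (inj₂ ax)
    ... | inj₁ refl = ⊥-elim (x∉W w∈W)
    ... | inj₂ wx   = Adj-sym wx

    completeTwinSet-missesClass : InducesComplete G W → ∀ {a x} → a ∈ W → x ∉ W →
      Adj G a x → ∀ {p} (Π : Partition n p) → Resolving G Π →
      ¬ OntoFrom W (cls Π)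
    completeTwinSet-missesClass complete {x = x} a∈W x∉W ax Π resolving onto
      with onto (cls Π x)
    ... | w , w∈W , w∼x =
      equalDistances⇒unresolved Π sameDistances (resolving x w x≢w)
      where
      x≢w : x ≢ w
      x≢w x≡w = x∉W (subst (_∈ W) (sym x≡w) w∈W)

      -- both x and w are at distance 0 from their class and 1 from any other
      sameDistances : ∀ j → ∃[ d ] (DistToClass G Π x j d × DistToClass G Π w j d)
      sameDistances j with cls Π x ≟ᶠ j | onto j
      ... | yes x∈j | _ = 0 ,
        subst (λ i → DistToClass G Π x i 0) x∈j (distToOwnClass Π x) ,
        subst (λ i → DistToClass G Π w i 0) (trans w∼x x∈j) (distToOwnClass Π w)
      ... | no x∉j | w′ , w′∈W , w′∈j = 1 ,
        distToNeighbourClass Π x∉j (completeTwinSet-neighbour complete a∈W x∉W ax w′ w′∈W) w′∈j ,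
        distToNeighbourClass Π w∉j (complete w w′ w∈W w′∈W w≢w′) w′∈j
        where
        w∉j : cls Π w ≢ j
        w∉j w∈j = x∉j (trans (sym w∼x) w∈j)
        w≢w′ : w ≢ w′
        w≢w′ w≡w′ = w∉j (trans (cong (cls Π) w≡w′) w′∈j)

    module _ (connected : Connected G) (3≤n : 3 ≤ n)
             (leaves : ∀ w → w ∈ W → IsLeaf G w) where

      leafTwins-shareNeighbour : ∀ {u v x} → u ∈ W → v ∈ W → Adj G u x → Adj G v x
      leafTwins-shareNeighbour {u} {v} {x} u∈W v∈W ux with u ≟ᶠ v
      ... | yes refl = ux
      ... | no u≢v with twinSet u v u∈W v∈W u≢v
      ... | inj₁ open-twins = Equivalence.to (open-twins x) ux
      ... | inj₂ closed-twins with Equivalence.to (closed-twins x) (inj₂ ux)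
      ... | inj₂ vx   = vx
      ... | inj₁ refl with leaves u u∈W | leaves v v∈W
      ... | _ , _ , onlyXu | _ , _ , onlyXv =
        ⊥-elim (noIsolatedEdge connected 3≤n onlyV onlyU)
        where
        onlyV : ∀ y → Adj G u y → y ≡ v
        onlyV y uy = trans (onlyXu y uy) (sym (onlyXu v ux))
        onlyU : ∀ y → Adj G v y → y ≡ u
        onlyU y vy = trans (onlyXv y vy) (sym (onlyXv u (Adj-sym ux)))

      leafTwinSet-missesClass : Nonempty W → ∀ {p} (Π : Partition n p) →
        Dominating G Π → ¬ OntoFrom W (cls Π)
      leafTwinSet-missesClass (w₀ , w₀∈W) Π dominating onto with leaves w₀ w₀∈W
      ... | x , w₀x , _ with onto (cls Π x)
      ... | w , w∈W , w∼x with leaves w w∈W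
      ... | _ , _ , onlyXw = leafUndominated Π onlyX (sym w∼x) (dominating w)
        where
        wx : Adj G w x
        wx = leafTwins-shareNeighbour w₀∈W w∈W w₀x
        onlyX : ∀ y → Adj G w y → y ≡ x
        onlyX y wy = trans (onlyXw y wy) (sym (onlyXw x wx))

mainTheorem17 : (n : ℕ) (G : Graph n) → Connected G → 3 ≤ n →
    (W : Subset n) → (∃[ v ] v ∉ W) → TwinSet G W → (k : ℕ) → ∣ W ∣ ≡ k → 2 ≤ k →
    (InducesEdgeless G W → ∀ b e → IsPartitionDimension G b → IsDomPartitionDimension G e →
    k ≤ b × b ≤ e)
    × (InducesComplete G W → ∀ b e → IsPartitionDimension G b → IsDomPartitionDimension G e →
    suc k ≤ b × b ≤ e)
    × ((∀ w → w ∈ W → IsLeaf G w) → ∀ e → IsDomPartitionDimension G e → suc k ≤ e)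
mainTheorem17 n G connected 3≤n W (y , y∉W) twinSet .(∣ W ∣) refl 2≤k =
    (λ _ b e ((Πb , Rb) , minb) ((Πe , Re , _) , _) →
      twinSet-bound G W twinSet Πb Rb , minb e Πe Re)
  , (λ complete b e ((Πb , Rb) , minb) ((Πe , Re , _) , _) →
      let (a , x , a∈W , x∉W , ax) = leavingEdge G (proj₂ nonempty) y∉W (proj₂ (connected _ y))
      in twinSet-strictBound G W twinSet Πb Rb
           (completeTwinSet-missesClass G W twinSet complete a∈W x∉W ax Πb Rb)
         , minb e Πe Re)
  , (λ leaves e ((Π , R , D) , _) →
      twinSet-strictBound G W twinSet Π R
        (leafTwinSet-missesClass G W twinSet connected 3≤n leaves nonempty Π D))
  where
  nonempty : Nonempty W
  nonempty = positive⇒nonempty W (≤-trans (s≤s z≤n) 2≤k)
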